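{- Let $p$ be a prime, $\alpha$ a positive integer and $\ell\ge 2$ an integer, and let $G=(\mathbb{Z}/p^{\alpha}\mathbb{Z})^{\ell}$. Then for every $(a_1,\dots,a_\ell)\in G$, the $(a_1,\dots,a_\ell)$-annihilator of $G$ is $[(a_1,\dots,a_\ell):G]=p^{\alpha}\mathbb{Z}$. In particular, the group-annihilator graph $\Gamma(G)$ is a complete graph.
   Context: For a finite abelian group $G$ viewed as a $\mathbb{Z}$-module and $x\in G$, $[x:G]=\{r\in\mathbb{Z} : rG\subseteq\mathbb{Z}x\}$, an ideal of $\mathbb{Z}$. The group-annihilator graph $\Gamma(G)$ is the simple graph with vertex set $G$ in which two distinct vertices $x,y$ are adjacent if and only if $[x:G][y:G]G=\{0\}$, where $[x:G][y:G]$ is the product of ideals of $\mathbb{Z}$. -}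

module Defs where

open import Data.Nat using (ℕ)
open import Data.Fin using (Fin; toℕ)
open import Data.Vec using (Vec; lookup)
open import Data.Integer using (ℤ; +_; _*_; _-_; _+_)
open import Data.Integer.Divisibility using (_∣_)
open import Data.List using (List; map; foldr)
open import Data.List.Relation.Unary.All using (All)
open import Data.Product using (Σ; ∃; _×_; proj₁; proj₂)
open import Relation.Binary.PropositionalEquality using (_≡_)
open import Relation.Nullary using (¬_)

Grp : ℕ → ℕ → Set
Grp n ℓ = Vec (Fin n) ℓ

coord : ∀ {n ℓ} → Grp n ℓ → Fin ℓ → ℤ
coord g i = + toℕ (lookup g i)

Ideal : Set₁
Ideal = ℤ → Set

-- r · g ∈ ℤ x  (in (ℤ/nℤ)^ℓ):  ∃ s ∈ ℤ with r·g = s·x, i.e. componentwise mod n.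
InCyclic : ∀ {n ℓ} → ℤ → Grp n ℓ → Grp n ℓ → Set
InCyclic {n} r g x = ∃ λ (s : ℤ) → ∀ i → (+ n) ∣ (r * coord g i - s * coord x i)

annihilator : ∀ {n ℓ} → Grp n ℓ → Ideal
annihilator {n} {ℓ} x r = (g : Grp n ℓ) → InCyclic r g x

_≐_ : Ideal → Ideal → Set
I ≐ J = ∀ r → (I r → J r) × (J r → I r)

principal : ℤ → Ideal
principal m r = m ∣ r

idealProduct : Ideal → Ideal → Ideal
idealProduct I J r =
  Σ (List (ℤ × ℤ)) λ ps →
    All (λ ab → I (proj₁ ab) × J (proj₂ ab)) ps ×
    r ≡ foldr _+_ (+ 0) (map (λ ab → proj₁ ab * proj₂ ab) ps)

-- I G = {0}: every r ∈ I and g ∈ G give r·g = 0 (componentwise mod n).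
-- (The submodule IG is generated by these r·g, so this is IG = {0}.)
KillsGrp : ℕ → ℕ → Ideal → Set
KillsGrp n ℓ I = ∀ r → I r → (g : Grp n ℓ) → ∀ i → (+ n) ∣ (r * coord g i)

Adjacent : ∀ {n ℓ} → Grp n ℓ → Grp n ℓ → Set
Adjacent {n} {ℓ} x y = KillsGrp n ℓ (idealProduct (annihilator x) (annihilator y))

IsComplete : ℕ → ℕ → Set
IsComplete n ℓ = (x y : Grp n ℓ) → ¬ (x ≡ y) → Adjacent x y

-- In ℤ/pᵏ the ideals form a chain: a residue prime to p is a unit, and otherwise one divides
-- out p. So of two coordinates aᵢ, aⱼ of a one is a multiple of the other, say aⱼ ≡ c·aᵢ.
-- If r ∈ [a : G], testing on the unit vector eⱼ gives s with r ≡ s·aⱼ and 0 ≡ s·aᵢ, hence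
-- r ≡ c·s·aᵢ ≡ 0. So [a : G] = pᵏℤ, and any product of such ideals lies in pᵏℤ, which kills G.
module Submission where

open import Defs
open import Data.Nat as ℕ using (ℕ; _^_; _≤_; zero; suc; z≤n; s≤s)
import Data.Nat.Properties as ℕ
open import Data.Nat.Divisibility as ℕ using (_∣?_)
open import Data.Nat.Coprimality as Coprimality using (Coprime)
open import Data.Nat.GCD using (module Bézout)
open import Data.Nat.Primality using (Prime; prime⇒irreducible; prime⇒nonTrivial)
open import Data.Integer as ℤ using (ℤ; +_; _+_; _-_; _*_; -_)
import Data.Integer.Properties as ℤ
open import Data.Integer.Divisibility.Signed
  using (_∣_; divides; ∣ᵤ⇒∣; ∣⇒∣ᵤ; ∣m∣n⇒∣m+n; ∣m⇒∣m*n; ∣n⇒∣m*n; ∣m⇒∣-m)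
open import Data.Integer.Tactic.RingSolver using (solve-∀)
open import Data.Fin using () renaming (zero to 0F; suc to sucF)
open import Data.Vec using (_∷_; replicate)
open import Data.List using ([]; _∷_; foldr; map)
open import Data.List.Relation.Unary.All using (All; []; _∷_)
open import Data.Product using (_×_; _,_; proj₁; proj₂)
open import Data.Sum as Sum using (_⊎_; inj₁; inj₂)
open import Data.Empty using (⊥-elim)
open import Function using (_∘_; _$_)
open import Relation.Nullary using (¬_; yes; no)
open import Relation.Binary.PropositionalEquality
  using (_≡_; refl; sym; cong; subst; subst₂; module ≡-Reasoning)

open ≡-Reasoning

¬∣⇒coprime : ∀ {p x} → Prime p → ¬ (p ℕ.∣ x) → Coprime x p
¬∣⇒coprime pp p∤x (d∣x , d∣p) with prime⇒irreducible pp d∣p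
... | inj₁ d≡1   = d≡1
... | inj₂ refl = ⊥-elim (p∤x d∣x)

coprime-*ʳ : ∀ {m n o} → Coprime m n → Coprime m o → Coprime m (n ℕ.* o)
coprime-*ʳ m⊥n m⊥o {d} (d∣m , d∣n*o) = m⊥o (d∣m , Coprimality.coprime-divisor d⊥n d∣n*o)
  where
  d⊥n : Coprime d _
  d⊥n (e∣d , e∣n) = m⊥n (ℕ.∣-trans e∣d d∣m , e∣n)

coprime-^ʳ : ∀ {m n} → Coprime m n → ∀ k → Coprime m (n ^ k)
coprime-^ʳ m⊥n zero    (_ , d∣1) = ℕ.∣1⇒≡1 d∣1
coprime-^ʳ m⊥n (suc k) = coprime-*ʳ m⊥n (coprime-^ʳ m⊥n k)

infix 4 _∣_mod_

record _∣_mod_ (x y : ℤ) (n : ℕ) : Set where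
  constructor multiple
  field
    factor     : ℤ
    congruence : + n ∣ y - factor * x

∣-mod-trans : ∀ {n x y z} → x ∣ y mod n → y ∣ z mod n → x ∣ z mod n
∣-mod-trans {n} {x} {y} {z} (multiple c n∣y-cx) (multiple d n∣z-dy) =
  multiple (d * c) $ subst (+ n ∣_) (identity x y z c d) (∣m∣n⇒∣m+n n∣z-dy (∣m⇒∣m*n d n∣y-cx))
  where
  identity : ∀ x y z c d → (z - d * y) + (y - c * x) * d ≡ z - (d * c) * x
  identity = solve-∀

1∣-mod : ∀ n z → + 1 ∣ z mod n
1∣-mod n z = multiple z $ divides (+ 0) (identity z)
  where
  identity : ∀ z → z - z * + 1 ≡ + 0 * + n
  identity = solve-∀

lift-1+*≡* : ∀ a b c d → 1 ℕ.+ a ℕ.* b ≡ c ℕ.* d → + 1 + + a * + b ≡ + c * + d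
lift-1+*≡* a b c d eq = begin
  + 1 + + a * + b        ≡⟨ cong (_+_ (+ 1)) (ℤ.pos-* a b) ⟨
  + 1 + + (a ℕ.* b)      ≡⟨ ℤ.pos-+ 1 (a ℕ.* b) ⟨
  + (1 ℕ.+ a ℕ.* b)      ≡⟨ cong +_ eq ⟩
  + (c ℕ.* d)            ≡⟨ ℤ.pos-* c d ⟩
  + c * + d              ∎

coprime⇒invertible-mod : ∀ {x n} → Coprime x n → + x ∣ + 1 mod n
coprime⇒invertible-mod {x} {n} x⊥n with Coprimality.coprime-Bézout x⊥n
... | Bézout.+- a b 1+bn≡ax = multiple (+ a) $ divides (- + b) (begin
  + 1 - + a * + x            ≡⟨ cong (_-_ (+ 1)) (sym (lift-1+*≡* b n a x 1+bn≡ax)) ⟩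
  + 1 - (+ 1 + + b * + n)    ≡⟨ identity₁ (+ b) (+ n) ⟩
  - + b * + n                ∎)
  where
  identity₁ : ∀ b n → + 1 - (+ 1 + b * n) ≡ - b * n
  identity₁ = solve-∀
... | Bézout.-+ a b 1+ax≡bn = multiple (- + a) $ divides (+ b) (begin
  + 1 - - + a * + x          ≡⟨ identity₂ (+ a) (+ x) ⟩
  + 1 + + a * + x            ≡⟨ lift-1+*≡* a x b n 1+ax≡bn ⟩
  + b * + n                  ∎)
  where
  identity₂ : ∀ a x → + 1 - - a * x ≡ + 1 + a * x
  identity₂ = solve-∀

invertible⇒∣-mod : ∀ {n x} → x ∣ + 1 mod n → ∀ z → x ∣ z mod n
invertible⇒∣-mod {n} x∣1 z = ∣-mod-trans x∣1 (1∣-mod n z)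

∣-mod-*ʳ : ∀ {n x y} d → x ∣ y mod n → x * + d ∣ y * + d mod d ℕ.* n
∣-mod-*ʳ {n} {x} {y} d (multiple c (divides q y-cx≡qn)) = multiple c $ divides q (begin
  y * + d - c * (x * + d)  ≡⟨ identity₁ x y c (+ d) ⟩
  (y - c * x) * + d        ≡⟨ cong (_* + d) y-cx≡qn ⟩
  q * + n * + d            ≡⟨ identity₂ q (+ n) (+ d) ⟩
  q * (+ d * + n)          ≡⟨ cong (q *_) (ℤ.pos-* d n) ⟨
  q * + (d ℕ.* n)          ∎)
  where
  identity₁ : ∀ x y c d → y * d - c * (x * d) ≡ (y - c * x) * d
  identity₁ = solve-∀
  identity₂ : ∀ q n d → q * n * d ≡ q * (d * n)
  identity₂ = solve-∀

∣-mod-prime-power-total : ∀ {p} → Prime p → ∀ k x y →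
  (+ x ∣ + y mod p ^ k) ⊎ (+ y ∣ + x mod p ^ k)
∣-mod-prime-power-total pp zero x y =
  inj₁ (multiple (+ y) (divides (+ y - + y * + x) (sym (ℤ.*-identityʳ _))))
∣-mod-prime-power-total {p} pp (suc k) x y with p ∣? x | p ∣? y
... | no p∤x | _ =
  inj₁ (invertible⇒∣-mod (coprime⇒invertible-mod (coprime-^ʳ (¬∣⇒coprime pp p∤x) (suc k))) (+ y))
... | yes _ | no p∤y =
  inj₂ (invertible⇒∣-mod (coprime⇒invertible-mod (coprime-^ʳ (¬∣⇒coprime pp p∤y) (suc k))) (+ x))
... | yes (ℕ.divides x′ refl) | yes (ℕ.divides y′ refl) =
  Sum.map (scale x′ y′) (scale y′ x′) (∣-mod-prime-power-total pp k x′ y′)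
  where
  scale : ∀ u v → + u ∣ + v mod p ^ k → + (u ℕ.* p) ∣ + (v ℕ.* p) mod p ^ suc k
  scale u v = subst₂ (_∣_mod p ^ suc k) (sym (ℤ.pos-* u p)) (sym (ℤ.pos-* v p)) ∘ ∣-mod-*ʳ p

∣-mod-annihilates : ∀ {n x y} s → x ∣ y mod n → + n ∣ s * x → + n ∣ s * y
∣-mod-annihilates {n} {x} {y} s (multiple c n∣y-cx) n∣sx =
  subst (+ n ∣_) (identity s x y c) (∣m∣n⇒∣m+n (∣n⇒∣m*n s n∣y-cx) (∣n⇒∣m*n c n∣sx))
  where
  identity : ∀ s x y c → s * (y - c * x) + c * (s * x) ≡ s * y
  identity = solve-∀

multiple-coordinate⇒∣ : ∀ {n ℓ r} (a g : Grp n ℓ) i j → coord g i ≡ + 0 → coord g j ≡ + 1 →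
  coord a i ∣ coord a j mod n → InCyclic r g a → + n ∣ r
multiple-coordinate⇒∣ {n} {r = r} a g i j gᵢ≡0 gⱼ≡1 aᵢ∣aⱼ (s , n∣rg-sa) =
  subst (+ n ∣_) (identity₁ r s (coord a j))
    (∣m∣n⇒∣m+n n∣r-saⱼ (∣-mod-annihilates s aᵢ∣aⱼ n∣saᵢ))
  where
  identity₁ : ∀ r s y → r * + 1 - s * y + s * y ≡ r
  identity₁ = solve-∀
  identity₂ : ∀ r s x → - (r * + 0 - s * x) ≡ s * x
  identity₂ = solve-∀
  n∣r-saⱼ : + n ∣ r * + 1 - s * coord a j
  n∣r-saⱼ = subst (λ t → + n ∣ r * t - s * coord a j) gⱼ≡1 (∣ᵤ⇒∣ (n∣rg-sa j))
  n∣saᵢ : + n ∣ s * coord a i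
  n∣saᵢ = subst (+ n ∣_) (identity₂ r s (coord a i))
    (∣m⇒∣-m (subst (λ t → + n ∣ r * t - s * coord a i) gᵢ≡0 (∣ᵤ⇒∣ (n∣rg-sa i))))

annihilator⊆multiples : ∀ {n m} → 2 ≤ n → (a : Grp n (suc (suc m))) →
  (coord a 0F ∣ coord a (sucF 0F) mod n) ⊎ (coord a (sucF 0F) ∣ coord a 0F mod n) →
  ∀ r → annihilator a r → + n ∣ r
annihilator⊆multiples {suc (suc _)} {m} (s≤s (s≤s z≤n)) a (inj₁ a₀∣a₁) r r∈[a:G] =
  multiple-coordinate⇒∣ a e₁ 0F (sucF 0F) refl refl a₀∣a₁ (r∈[a:G] e₁)
  where e₁ = 0F ∷ sucF 0F ∷ replicate m 0F
annihilator⊆multiples {suc (suc _)} {m} (s≤s (s≤s z≤n)) a (inj₂ a₁∣a₀) r r∈[a:G] =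
  multiple-coordinate⇒∣ a e₀ (sucF 0F) 0F refl refl a₁∣a₀ (r∈[a:G] e₀)
  where e₀ = sucF 0F ∷ 0F ∷ replicate m 0F

multiples⊆annihilator : ∀ {n ℓ} (a : Grp n ℓ) r → + n ∣ r → annihilator a r
multiples⊆annihilator a r n∣r g = + 0 , λ i →
  ∣⇒∣ᵤ (subst (_ ∣_) (identity r (coord g i) (coord a i)) (∣m⇒∣m*n (coord g i) n∣r))
  where
  identity : ∀ r y x → r * y ≡ r * y - + 0 * x
  identity = solve-∀

idealProduct⊆ˡ : ∀ {I J : Ideal} {m} → (∀ a → I a → m ∣ a) → ∀ r → idealProduct I J r → m ∣ r
idealProduct⊆ˡ {I} {J} {m} I⊆m r (ps , ps∈I×J , refl) = sum-of-products ps ps∈I×J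
  where
  sum-of-products : ∀ ps → All (λ ab → I (proj₁ ab) × J (proj₂ ab)) ps →
    m ∣ foldr _+_ (+ 0) (map (λ ab → proj₁ ab * proj₂ ab) ps)
  sum-of-products []             []                = divides (+ 0) refl
  sum-of-products ((a , b) ∷ ps) ((a∈I , _) ∷ ps∈) =
    ∣m∣n⇒∣m+n (∣m⇒∣m*n b (I⊆m a a∈I)) (sum-of-products ps ps∈)

multiples-kill : ∀ {n ℓ} {I : Ideal} → (∀ r → I r → + n ∣ r) → KillsGrp n ℓ I
multiples-kill I⊆n r r∈I g i = ∣⇒∣ᵤ (∣m⇒∣m*n (coord g i) (I⊆n r r∈I))

theorem2 : (p α ℓ : ℕ) → Prime p → 1 ≤ α → 2 ≤ ℓ →
    ((a : Grp (p ^ α) ℓ) → annihilator a ≐ principal (+ (p ^ α)))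
    × IsComplete (p ^ α) ℓ
theorem2 p α (suc (suc m)) pp α≥1 (s≤s (s≤s z≤n)) =
  (λ a r → ∣⇒∣ᵤ ∘ [a:G]⊆pᵅℤ a r , multiples⊆annihilator a r ∘ ∣ᵤ⇒∣) ,
  λ x y _ → multiples-kill (idealProduct⊆ˡ ([a:G]⊆pᵅℤ x))
  where
  instance _ = prime⇒nonTrivial pp
  2≤pᵅ : 2 ≤ p ^ α
  2≤pᵅ = ℕ.^-monoʳ-< p (ℕ.nonTrivial⇒n>1 p) α≥1
  [a:G]⊆pᵅℤ : (a : Grp (p ^ α) (suc (suc m))) → ∀ r → annihilator a r → + (p ^ α) ∣ r
  [a:G]⊆pᵅℤ a = annihilator⊆multiples 2≤pᵅ a (∣-mod-prime-power-total pp α _ _)
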